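{- Let $\Delta=\Gamma_1\,\square\cdots\square\,\Gamma_b$ be a simple Cartesian product such that $\Delta$ is connected and $\Delta$ is arc-transitive. Then there exists a graph $\Gamma_0$ such that $\Gamma_i=\Gamma_0$ for all $i\in\{1,\dots,b\}$ (i.e. $V\Gamma_i=V\Gamma_0$ and $E\Gamma_i=E\Gamma_0$).
   Context: Graphs are finite, undirected and without loops. The Cartesian product $\Gamma_1\,\square\cdots\square\,\Gamma_b$ has vertex set $V\Gamma_1\times\cdots\times V\Gamma_b$, with $(\alpha_1,\dots,\alpha_b)$ adjacent to $(\beta_1,\dots,\beta_b)$ iff there is an $i$ with $\{\alpha_i,\beta_i\}\in E\Gamma_i$ and $\alpha_j=\beta_j$ for all $j\ne i$. A graph $\Gamma$ is Cartesian-prime if $|V\Gamma|>1$ and there is no isomorphism $\Gamma\cong\Gamma_1\,\square\cdots\square\,\Gamma_b$ with $b>1$ and each $\Gamma_i$ having at least two vertices. The product $\Delta=\Gamma_1\,\square\cdots\square\,\Gamma_b$ is called simple if (i) $b>1$ and each $\Gamma_i$ is Cartesian-prime, and (ii) for $1\le j<k\le b$, if $\Gamma_j\cong\Gamma_k$ then $\Gamma_j=\Gamma_k$ (same vertex set and same edge set). A graph is arc-transitive if its automorphism group acts transitively on ordered pairs $(\alpha,\beta)$ with $\{\alpha,\beta\}$ an edge. -}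

module Defs where

open import Data.Nat using (ℕ; _<_; _≤_)
open import Data.Fin using (Fin; zero; suc)
open import Data.Bool using (Bool; true; false)
open import Data.Vec using (Vec; []; _∷_; lookup)
open import Data.Unit using (⊤)
open import Data.Product using (Σ; Σ-syntax; ∃; _×_; _,_; proj₁)
open import Relation.Nullary using (¬_)
open import Relation.Binary.PropositionalEquality using (_≡_; _≢_; subst)
open import Relation.Binary.Construct.Closure.ReflexiveTransitive using (Star)
open import Function.Bundles using (_↔_; _⇔_; Inverse)

record Graph : Set where
  field
    order  : ℕ
    adj    : Fin order → Fin order → Bool
    sym    : ∀ u v → adj u v ≡ adj v u
    irrefl : ∀ v → adj v v ≡ false
open Graph public

Edge : (G : Graph) → Fin (order G) → Fin (order G) → Set
Edge G u v = adj G u v ≡ true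

GraphEq : Graph → Graph → Set
GraphEq G H = Σ (order G ≡ order H) λ p →
  ∀ u v → adj G u v ≡ adj H (subst Fin p u) (subst Fin p v)

Iso : (V : Set) → (V → V → Set) → (W : Set) → (W → W → Set) → Set
Iso V E W F = Σ (V ↔ W) λ f →
  ∀ u v → E u v ⇔ F (Inverse.to f u) (Inverse.to f v)

GraphIso : Graph → Graph → Set
GraphIso G H = Iso (Fin (order G)) (Edge G) (Fin (order H)) (Edge H)

ProdV : ∀ {b} → Vec Graph b → Set
ProdV []       = ⊤
ProdV (G ∷ Gs) = Fin (order G) × ProdV Gs

coord : ∀ {b} {Gs : Vec Graph b} → ProdV Gs → (i : Fin b) → Fin (order (lookup Gs i))
coord {Gs = G ∷ Gs} (x , xs) zero    = x
coord {Gs = G ∷ Gs} (x , xs) (suc i) = coord xs i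

ProdE : ∀ {b} (Gs : Vec Graph b) → ProdV Gs → ProdV Gs → Set
ProdE {b} Gs x y = Σ[ i ∈ Fin b ]
  (Edge (lookup Gs i) (coord x i) (coord y i) × (∀ j → j ≢ i → coord x j ≡ coord y j))

CartesianPrime : Graph → Set
CartesianPrime Γ = 1 < order Γ ×
  ¬ (Σ ℕ λ b → Σ (Vec Graph b) λ Gs →
       1 < b × (∀ i → 2 ≤ order (lookup Gs i)) ×
       Iso (Fin (order Γ)) (Edge Γ) (ProdV Gs) (ProdE Gs))

SimpleProduct : ∀ {b} → Vec Graph b → Set
SimpleProduct {b} Gs = 1 < b × (∀ i → CartesianPrime (lookup Gs i)) ×
  (∀ (j k : Fin b) → j Data.Fin.< k →
     GraphIso (lookup Gs j) (lookup Gs k) → GraphEq (lookup Gs j) (lookup Gs k))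

Connected : (V : Set) → (V → V → Set) → Set
Connected V E = ∀ u v → Star E u v

ArcTransitive : (V : Set) → (V → V → Set) → Set
ArcTransitive V E = ∀ α β α' β' → E α β → E α' β' →
  Σ (Iso V E V E) λ g → (Inverse.to (proj₁ g) α ≡ α') × (Inverse.to (proj₁ g) β ≡ β')

-- Fix a vertex x and two directions i, j. By arc-transitivity some automorphism g maps an
-- edge of the i-layer through x onto an edge of the j-layer through x. The image S of that
-- i-layer is an induced copy of Γᵢ. Two distinct vertices of a layer have all their common
-- neighbours inside the layer, hence so do two distinct vertices of S; completing squares
-- then shows that S is closed under giving one vertex the j-coordinate of another. So
-- S ≅ A □ B, where A and B are the projections of S to coordinate j and to the remaining
-- coordinates. As Γᵢ is prime and A contains an edge, B is a single vertex: S lies in a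
-- j-layer and Γᵢ embeds into Γⱼ. Embeddings in both directions between finite graphs are
-- isomorphisms, and simplicity turns isomorphic factors into equal ones.

module Submission where

open import Defs hiding (sym)
open import Data.Nat as ℕ using (ℕ; zero; suc; z≤n; s≤s)
import Data.Nat.Properties as ℕ
open import Data.Fin as Fin using (Fin; zero; suc; punchIn; punchOut)
open import Data.Fin.Properties using (any?; all?; injective⇒≤; punchOut-injective; punchInᵢ≢i)
open import Data.Bool as Bool using (true)
open import Data.List as List using (List; _∷_; length; allFin; deduplicate)
open import Data.List.Membership.Propositional.Properties
  using (∈-map⁺; ∈-map⁻; ∈-allFin; ∈-lookup; ∈-deduplicate⁺; ∈-deduplicate⁻)
open import Data.List.Relation.Unary.Any as Any using ()
open import Data.List.Relation.Unary.Any.Properties using (lookup-index)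
open import Data.List.Relation.Unary.All as All using ()
open import Data.List.Relation.Unary.AllPairs using (_∷_)
open import Data.List.Relation.Unary.Unique.Propositional using (Unique)
open import Data.List.Relation.Unary.Unique.DecPropositional.Properties using (deduplicate-!)
open import Data.Vec using (Vec; []; _∷_; lookup)
open import Data.Unit using (tt)
open import Data.Product using (Σ; ∃; _×_; _,_; proj₁; proj₂)
open import Function using (_∘_)
open import Function.Bundles using (Inverse; Equivalence; mk⇔; mk↔ₛ′; _⇔_)
open import Function.Definitions using (Injective)
import Function.Properties.Equivalence as ⇔
open import Relation.Nullary using (¬_; Dec; yes; no; does; contradiction)
open import Relation.Nullary.Decidable using (dec-false; does-⇔; _×-dec_; _→-dec_; ¬?)
open import Relation.Binary.Definitions using (DecidableEquality; Decidable; Symmetric)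
open import Relation.Binary.PropositionalEquality
open import Relation.Binary.Construct.Closure.ReflexiveTransitive as Star using (Star; ε; _◅_)

edge-sym : (G : Graph) → Symmetric (Edge G)
edge-sym G {u} {v} e = trans (Graph.sym G v u) e

edge-irrefl : (G : Graph) → ∀ {u} → ¬ Edge G u u
edge-irrefl G {u} e with trans (sym e) (irrefl G u)
... | ()

edge⇒≢ : (G : Graph) → ∀ {u v} → Edge G u v → u ≢ v
edge⇒≢ G e refl = edge-irrefl G e

edge? : (G : Graph) → Decidable (Edge G)
edge? G u v = adj G u v Bool.≟ true

does≡true⇔ : ∀ {A : Set} (a? : Dec A) → does a? ≡ true ⇔ A
does≡true⇔ (yes a) = mk⇔ (λ _ → a) (λ _ → refl)
does≡true⇔ (no ¬a) = mk⇔ (λ ()) (λ a → contradiction a ¬a)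

GraphEq-sym : ∀ {G H} → GraphEq G H → GraphEq H G
GraphEq-sym (refl , adj≡) = refl , λ u v → sym (adj≡ u v)

connected⇒neighbour : ∀ {n} {E : Fin n → Fin n → Set} →
                      (∀ a a' → Star E a a') → 1 ℕ.< n → ∀ a → ∃ (E a)
connected⇒neighbour {E = E} conn (s≤s (s≤s _)) a =
  first-step (conn a (punchIn a zero)) (punchInᵢ≢i a zero ∘ sym)
  where
  first-step : ∀ {a'} → Star E a a' → a ≢ a' → ∃ (E a)
  first-step ε       a≢a = contradiction refl a≢a
  first-step (e ◅ _) _   = _ , e

record Embedding (G H : Graph) : Set where
  field
    map       : Fin (order G) → Fin (order H)
    injective : Injective _≡_ _≡_ map
    edge⇔     : ∀ a a' → Edge G a a' ⇔ Edge H (map a) (map a')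

injective⇒surjective : ∀ {m n} {f : Fin m → Fin n} → Injective _≡_ _≡_ f → n ℕ.≤ m →
                       ∀ y → ∃ λ x → f x ≡ y
injective⇒surjective {n = suc n} {f} f-inj n≤m y with any? (λ x → f x Fin.≟ y)
... | yes found  = found
... | no missing = contradiction (ℕ.≤-trans n≤m (injective⇒≤ g-inj)) ℕ.1+n≰n
  where
  f≢y : ∀ x → y ≢ f x
  f≢y x y≡fx = missing (x , sym y≡fx)
  g-inj : Injective _≡_ _≡_ (λ x → punchOut (f≢y x))
  g-inj = f-inj ∘ punchOut-injective (f≢y _) (f≢y _)

mutualEmbeddings⇒iso : ∀ {G H} → Embedding G H → Embedding H G → GraphIso G H
mutualEmbeddings⇒iso {G} {H} φ ψ =
  mk↔ₛ′ φ.map from (λ y → proj₂ (onto y)) (λ x → φ.injective (proj₂ (onto (φ.map x)))) , φ.edge⇔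
  where
  module φ = Embedding φ
  onto : ∀ y → ∃ λ x → φ.map x ≡ y
  onto = injective⇒surjective φ.injective (injective⇒≤ (Embedding.injective ψ))
  from : Fin (order H) → Fin (order G)
  from y = proj₁ (onto y)

lookup-injective : ∀ {A : Set} {xs : List A} → Unique xs → Injective _≡_ _≡_ (List.lookup xs)
lookup-injective {xs = _ ∷ _}  (_ ∷ _)    {zero}  {zero}  _  = refl
lookup-injective {xs = _ ∷ _}  (x∉ ∷ _)   {zero}  {suc j} eq = contradiction eq (All.lookup x∉ (∈-lookup j))
lookup-injective {xs = _ ∷ _}  (x∉ ∷ _)   {suc i} {zero}  eq = contradiction (sym eq) (All.lookup x∉ (∈-lookup i))
lookup-injective {xs = _ ∷ _}  (_ ∷ uniq) {suc i} {suc j} eq = cong suc (lookup-injective uniq eq)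

module ImageGraph {n} {K : Set} (_≟_ : DecidableEquality K) (key : Fin n → K)
                  (E : K → K → Set) (E? : Decidable E) (E-sym : Symmetric E)
                  (E-irrefl : ∀ {κ} → ¬ E κ κ) where

  keys : List K
  keys = deduplicate _≟_ (List.map key (allFin n))

  keys-unique : Unique keys
  keys-unique = deduplicate-! _≟_ _

  graph : Graph
  graph = record
    { order  = length keys
    ; adj    = λ u v → does (E? (List.lookup keys u) (List.lookup keys v))
    ; sym    = λ u v → does-⇔ (mk⇔ E-sym E-sym) (E? _ _) (E? _ _)
    ; irrefl = λ u → dec-false (E? _ _) E-irrefl
    }

  class : Fin n → Fin (order graph)
  class a = Any.index (∈-deduplicate⁺ _≟_ (∈-map⁺ key (∈-allFin a)))

  lookup-class : ∀ a → List.lookup keys (class a) ≡ key a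
  lookup-class a = sym (lookup-index (∈-deduplicate⁺ _≟_ (∈-map⁺ key (∈-allFin a))))

  class-≡⇔ : ∀ {a a'} → class a ≡ class a' ⇔ key a ≡ key a'
  class-≡⇔ {a} {a'} = mk⇔
    (λ eq → trans (sym (lookup-class a)) (trans (cong (List.lookup keys) eq) (lookup-class a')))
    (λ eq → lookup-injective keys-unique (trans (lookup-class a) (trans eq (sym (lookup-class a')))))

  class-surjective : ∀ u → ∃ λ a → class a ≡ u
  class-surjective u with ∈-map⁻ key (∈-deduplicate⁻ _≟_ (List.map key (allFin n)) (∈-lookup {xs = keys} u))
  ... | a , _ , u≡a = a , lookup-injective keys-unique (trans (lookup-class a) (sym u≡a))

  edge-class⇔ : ∀ a a' → Edge graph (class a) (class a') ⇔ E (key a) (key a')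
  edge-class⇔ a a' = via (lookup-class a) (lookup-class a')
    where
    via : ∀ {κ κ'} → κ ≡ key a → κ' ≡ key a' → does (E? κ κ') ≡ true ⇔ E (key a) (key a')
    via refl refl = does≡true⇔ (E? _ _)

  two-classes : ∀ {a a'} → key a ≢ key a' → 2 ℕ.≤ order graph
  two-classes {a} {a'} keys≢ = distinct⇒2≤ (keys≢ ∘ Equivalence.to class-≡⇔)
    where
    distinct⇒2≤ : ∀ {m} {u v : Fin m} → u ≢ v → 2 ℕ.≤ m
    distinct⇒2≤ {suc zero}    {zero} {zero} u≢v = contradiction refl u≢v
    distinct⇒2≤ {suc (suc _)} _ = s≤s (s≤s z≤n)

_[_]≔_ : ∀ {b} {Gs : Vec Graph b} → ProdV Gs → (i : Fin b) → Fin (order (lookup Gs i)) → ProdV Gs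
_[_]≔_ {Gs = G ∷ Gs} (x , xs) zero    a = a , xs
_[_]≔_ {Gs = G ∷ Gs} (x , xs) (suc i) a = x , xs [ i ]≔ a

coord-≔ : ∀ {b} {Gs : Vec Graph b} (x : ProdV Gs) i a → coord (x [ i ]≔ a) i ≡ a
coord-≔ {Gs = G ∷ Gs} (x , xs) zero    a = refl
coord-≔ {Gs = G ∷ Gs} (x , xs) (suc i) a = coord-≔ xs i a

coord-≔-≢ : ∀ {b} {Gs : Vec Graph b} (x : ProdV Gs) {i k} a → k ≢ i → coord (x [ i ]≔ a) k ≡ coord x k
coord-≔-≢ {Gs = G ∷ Gs} (x , xs) {zero}  {zero}  a k≢i = contradiction refl k≢i
coord-≔-≢ {Gs = G ∷ Gs} (x , xs) {zero}  {suc k} a k≢i = refl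
coord-≔-≢ {Gs = G ∷ Gs} (x , xs) {suc i} {zero}  a k≢i = refl
coord-≔-≢ {Gs = G ∷ Gs} (x , xs) {suc i} {suc k} a k≢i = coord-≔-≢ xs a (k≢i ∘ cong suc)

coord-ext : ∀ {b} {Gs : Vec Graph b} {x y : ProdV Gs} → (∀ k → coord x k ≡ coord y k) → x ≡ y
coord-ext {Gs = []}     {tt}     {tt}     _ = refl
coord-ext {Gs = G ∷ Gs} {x , xs} {y , ys} h = cong₂ _,_ (h zero) (coord-ext (λ k → h (suc k)))

tabulateᵥ : ∀ {b} {Gs : Vec Graph b} → (∀ i → Fin (order (lookup Gs i))) → ProdV Gs
tabulateᵥ {Gs = []}     x = tt
tabulateᵥ {Gs = G ∷ Gs} x = x zero , tabulateᵥ (x ∘ suc)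

_≟ᵥ_ : ∀ {b} {Gs : Vec Graph b} → DecidableEquality (ProdV Gs)
_≟ᵥ_ {Gs = []}     tt       tt       = yes refl
_≟ᵥ_ {Gs = G ∷ Gs} (x , xs) (y , ys) with x Fin.≟ y | xs ≟ᵥ ys
... | yes refl | yes refl = yes refl
... | no x≢y   | _        = no λ { refl → x≢y refl }
... | yes _    | no xs≢ys = no λ { refl → xs≢ys refl }

module Product {b} (Gs : Vec Graph b) where

  Γ : Fin b → Graph
  Γ = lookup Gs

  V : Set
  V = ProdV Gs

  AgreeOff : Fin b → V → V → Set
  AgreeOff i x y = ∀ k → k ≢ i → coord x k ≡ coord y k

  EdgeAt : Fin b → V → V → Set
  EdgeAt i x y = Edge (Γ i) (coord x i) (coord y i) × AgreeOff i x y

  CommonNeighbourClosed : ∀ {X : Set} → (X → V) → Set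
  CommonNeighbourClosed f =
    ∀ {p q w} → f p ≢ f q → ProdE Gs (f p) w → ProdE Gs (f q) w → ∃ λ r → f r ≡ w

  MixingClosed : ∀ {X : Set} → (X → V) → Fin b → Set
  MixingClosed f j = ∀ t a → ∃ λ z → f z ≡ f a [ j ]≔ coord (f t) j

  agreeOff-sym : ∀ {i} → Symmetric (AgreeOff i)
  agreeOff-sym h k k≢i = sym (h k k≢i)

  agreeOff-trans : ∀ {i x y z} → AgreeOff i x y → AgreeOff i y z → AgreeOff i x z
  agreeOff-trans h h' k k≢i = trans (h k k≢i) (h' k k≢i)

  agreeOff? : ∀ i → Decidable (AgreeOff i)
  agreeOff? i x y = all? λ k → ¬? (k Fin.≟ i) →-dec (coord x k Fin.≟ coord y k)

  agreeOff-≔ : ∀ (x : V) i a → AgreeOff i (x [ i ]≔ a) x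
  agreeOff-≔ x i a k = coord-≔-≢ x a

  agreeOff⇒≡ : ∀ {i x y} → AgreeOff i x y → coord x i ≡ coord y i → x ≡ y
  agreeOff⇒≡ {i} {x} {y} h xi≡yi = coord-ext pointwise
    where
    pointwise : ∀ k → coord x k ≡ coord y k
    pointwise k with k Fin.≟ i
    ... | yes refl = xi≡yi
    ... | no  k≢i  = h k k≢i

  ≔-agreeOff : ∀ {d x y} j c → AgreeOff d x y → AgreeOff d (x [ j ]≔ c) (y [ j ]≔ c)
  ≔-agreeOff {x = x} {y} j c h k k≢d with k Fin.≟ j
  ... | yes refl = trans (coord-≔ x k c) (sym (coord-≔ y k c))
  ... | no  k≢j  = trans (coord-≔-≢ x c k≢j) (trans (h k k≢d) (sym (coord-≔-≢ y c k≢j)))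

  agreeOff⇒≔-≡ : ∀ {i x y} c → AgreeOff i x y → x [ i ]≔ c ≡ y [ i ]≔ c
  agreeOff⇒≔-≡ {i} {x} {y} c h = agreeOff⇒≡ (≔-agreeOff i c h) (trans (coord-≔ x i c) (sym (coord-≔ y i c)))

  ≔-coord : ∀ (x : V) i → x [ i ]≔ coord x i ≡ x
  ≔-coord x i = agreeOff⇒≡ (agreeOff-≔ x i _) (coord-≔ x i _)

  ≔-move : ∀ {d j x y} c → d ≢ j → AgreeOff d x y → (x [ j ]≔ c) [ d ]≔ coord y d ≡ y [ j ]≔ c
  ≔-move {d} {j} {x} {y} c d≢j h =
    agreeOff⇒≡ (agreeOff-trans (agreeOff-≔ _ d _) (≔-agreeOff j c h))
               (trans (coord-≔ (x [ j ]≔ c) d (coord y d)) (sym (coord-≔-≢ y c d≢j)))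

  EdgeAt-sym : ∀ {i} → Symmetric (EdgeAt i)
  EdgeAt-sym {i} (e , h) = edge-sym (Γ i) e , agreeOff-sym h

  ProdE-sym : Symmetric (ProdE Gs)
  ProdE-sym (i , e) = i , EdgeAt-sym e

  ProdE-irrefl : ∀ {x} → ¬ ProdE Gs x x
  ProdE-irrefl (i , e , _) = edge-irrefl (Γ i) e

  ProdE? : Decidable (ProdE Gs)
  ProdE? x y = any? λ i → edge? (Γ i) _ _ ×-dec agreeOff? i x y

  EdgeAt-≔ : ∀ {d j x y} c → d ≢ j → EdgeAt d x y → EdgeAt d (x [ j ]≔ c) (y [ j ]≔ c)
  EdgeAt-≔ {d} {j} {x} {y} c d≢j (e , h) =
    subst₂ (Edge (Γ d)) (sym (coord-≔-≢ x c d≢j)) (sym (coord-≔-≢ y c d≢j)) e , ≔-agreeOff j c h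

  EdgeAt-≔⁻ : ∀ {d j x y} c → d ≢ j → coord x j ≡ coord y j →
              EdgeAt d (x [ j ]≔ c) (y [ j ]≔ c) → EdgeAt d x y
  EdgeAt-≔⁻ {d} {j} {x} {y} c d≢j xj≡yj (e , h) =
    subst₂ (Edge (Γ d)) (coord-≔-≢ x c d≢j) (coord-≔-≢ y c d≢j) e , agree
    where
    agree : AgreeOff d x y
    agree k k≢d with k Fin.≟ j
    ... | yes refl = xj≡yj
    ... | no  k≢j  = trans (sym (coord-≔-≢ x c k≢j)) (trans (h k k≢d) (coord-≔-≢ y c k≢j))

  ¬EdgeAt-≔ : ∀ {j x y} c → ¬ EdgeAt j (x [ j ]≔ c) (y [ j ]≔ c)
  ¬EdgeAt-≔ {j} {x} {y} c (e , _) = edge-irrefl (Γ j) (subst₂ (Edge (Γ j)) (coord-≔ x j c) (coord-≔ y j c) e)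

  layer-EdgeAt : ∀ (x : V) i {a a'} → Edge (Γ i) a a' → EdgeAt i (x [ i ]≔ a) (x [ i ]≔ a')
  layer-EdgeAt x i {a} {a'} e = subst₂ (Edge (Γ i)) (sym (coord-≔ x i a)) (sym (coord-≔ x i a')) e
                              , agreeOff-trans (agreeOff-≔ x i a) (agreeOff-sym (agreeOff-≔ x i a'))

  ≔-EdgeAt : ∀ (x : V) i {c} → Edge (Γ i) (coord x i) c → EdgeAt i x (x [ i ]≔ c)
  ≔-EdgeAt x i e = subst (λ y → EdgeAt i y (x [ i ]≔ _)) (≔-coord x i) (layer-EdgeAt x i e)

  layer-edge⇔ : ∀ (x : V) i {a a'} → Edge (Γ i) a a' ⇔ ProdE Gs (x [ i ]≔ a) (x [ i ]≔ a')
  layer-edge⇔ x i {a} {a'} = mk⇔ (λ e → i , layer-EdgeAt x i e) from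
    where
    from : ProdE Gs (x [ i ]≔ a) (x [ i ]≔ a') → Edge (Γ i) a a'
    from (d , e , _) with d Fin.≟ i
    ... | yes refl = subst₂ (Edge (Γ i)) (coord-≔ x i a) (coord-≔ x i a') e
    ... | no  d≢i  =
      contradiction (subst₂ (Edge (Γ d)) (coord-≔-≢ x a d≢i) (coord-≔-≢ x a' d≢i) e) (edge-irrefl (Γ d))

  layer-commonNeighbour : ∀ (x : V) i {a a' y} → a ≢ a' →
                          ProdE Gs (x [ i ]≔ a) y → ProdE Gs (x [ i ]≔ a') y → AgreeOff i y x
  layer-commonNeighbour x i {a} {a'} a≢a' (d₁ , _ , h₁) (d₂ , _ , h₂) with d₁ Fin.≟ i | d₂ Fin.≟ i
  ... | yes refl | _        = agreeOff-trans (agreeOff-sym h₁) (agreeOff-≔ x i a)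
  ... | no _     | yes refl = agreeOff-trans (agreeOff-sym h₂) (agreeOff-≔ x i a')
  ... | no d₁≢i  | no d₂≢i  = contradiction
    (trans (sym (coord-≔ x i a)) (trans (h₁ i (≢-sym d₁≢i)) (trans (sym (h₂ i (≢-sym d₂≢i))) (coord-≔ x i a'))))
    a≢a'

  completeSquare : ∀ {d j u v u'} → d ≢ j → EdgeAt j u v → EdgeAt d u u' →
                   EdgeAt j u' (v [ d ]≔ coord u' d) × EdgeAt d v (v [ d ]≔ coord u' d)
  completeSquare {d} {j} {u} {v} {u'} d≢j (eⱼ , hⱼ) (e_d , h_d) =
      ( subst₂ (Edge (Γ j)) (h_d j (≢-sym d≢j)) (sym (coord-≔-≢ v _ (≢-sym d≢j))) eⱼ , agree )
    , ( subst₂ (Edge (Γ d)) (hⱼ d d≢j) (sym (coord-≔ v d _)) e_d , agreeOff-sym (agreeOff-≔ v d _) )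
    where
    agree : AgreeOff j u' (v [ d ]≔ coord u' d)
    agree k k≢j with k Fin.≟ d
    ... | yes refl = sym (coord-≔ v k _)
    ... | no  k≢d  = trans (sym (h_d k k≢d)) (trans (hⱼ k k≢j) (sym (coord-≔-≢ v _ k≢d)))

  completeSquare-≢ : ∀ {d j u v u'} → d ≢ j → EdgeAt j u v → EdgeAt d u u' → u' ≢ v
  completeSquare-≢ {d} d≢j (_ , hⱼ) (e , _) refl = edge⇒≢ (Γ d) e (hⱼ d d≢j)

  project-walk : ∀ i {x y} → Star (ProdE Gs) x y → Star (Edge (Γ i)) (coord x i) (coord y i)
  project-walk i ε = ε
  project-walk i ((d , e , h) ◅ w) with d Fin.≟ i
  ... | yes refl = e ◅ project-walk i w
  ... | no  d≢i  = subst (λ c → Star (Edge (Γ i)) c _) (sym (h i (≢-sym d≢i))) (project-walk i w)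

  factor-connected : Connected V (ProdE Gs) → V → ∀ i a a' → Star (Edge (Γ i)) a a'
  factor-connected conn x i a a' =
    subst₂ (Star (Edge (Γ i))) (coord-≔ x i a) (coord-≔ x i a') (project-walk i (conn (x [ i ]≔ a) (x [ i ]≔ a')))

module SquareCompletion {b} (Gs : Vec Graph b) {X : Set} (f : X → ProdV Gs)
                        (closed : Product.CommonNeighbourClosed Gs f) (j : Fin b) where
  open Product Gs

  JStep : X → X → Set
  JStep p q = EdgeAt j (f p) (f q)

  -- Each square spanned by a step of the j-walk and the d-edge is completed inside the
  -- image by common-neighbour closure.
  transport : ∀ {d p q p'} → d ≢ j → Star JStep p q → EdgeAt d (f p) (f p') →
              ∃ λ q' → f q' ≡ f q [ d ]≔ coord (f p') d × Star JStep p' q'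
  transport {d} {p} {p' = p'} d≢j ε (_ , h) = p' , sym (trans (agreeOff⇒≔-≡ _ h) (≔-coord (f p') d)) , ε
  transport {d} {p} {q} {p'} d≢j (_◅_ {j = p₁} s walk) e
    with completeSquare d≢j s e
  ... | e' , e'' with closed (completeSquare-≢ d≢j s e) (j , e') (d , e'')
  ...   | r , fr≡ with transport d≢j walk (subst (EdgeAt d (f p₁)) (sym fr≡) e'')
  ...     | q' , fq'≡ , walk' =
    q' , trans fq'≡ (cong (f q [ d ]≔_) (trans (cong (λ y → coord y d) fr≡) (coord-≔ (f p₁) d _)))
       , subst (EdgeAt j (f p')) (sym fr≡) e' ◅ walk'

  -- The j-walk is kept because transport moves it across edges in the other directions.
  Reachable : Fin (order (Γ j)) → X → Set
  Reachable c m = ∃ λ z → f z ≡ f m [ j ]≔ c × Star JStep m z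

  reachable-step : ∀ {c m m'} → ProdE Gs (f m) (f m') → Reachable c m → Reachable c m'
  reachable-step {c} {m} {m'} (d , e) (z , fz≡ , walk) with d Fin.≟ j
  ... | yes refl = z , trans fz≡ (agreeOff⇒≔-≡ c (proj₂ e)) , EdgeAt-sym e ◅ walk
  ... | no  d≢j with transport d≢j walk e
  ...   | z' , fz'≡ , walk' =
    z' , trans fz'≡ (trans (cong (_[ d ]≔ coord (f m') d) fz≡) (≔-move c d≢j (proj₂ e))) , walk'

  reachable-along : ∀ {c m m'} → Star (λ m m' → ProdE Gs (f m) (f m')) m m' → Reachable c m → Reachable c m'
  reachable-along ε          reach = reach
  reachable-along (e ◅ walk) reach = reachable-along walk (reachable-step e reach)

  mixingClosed : (∀ p q → Star (λ m m' → ProdE Gs (f m) (f m')) p q) → MixingClosed f j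
  mixingClosed connected t a with reachable-along (connected t a) (t , sym (≔-coord (f t) j) , ε)
  ... | z , fz≡ , _ = z , fz≡

module InducedSubgraph {b} (Gs : Vec Graph b) (G : Graph) (f : Fin (order G) → ProdV Gs)
                       (f-injective : Injective _≡_ _≡_ f)
                       (f-edge⇔ : ∀ a a' → Edge G a a' ⇔ ProdE Gs (f a) (f a')) (j : Fin b) where
  open Product Gs

  InLayer : Set
  InLayer = ∀ a a' → AgreeOff j (f a) (f a')

  inLayer⇒embedding : InLayer → Embedding G (Γ j)
  inLayer⇒embedding inLayer = record
    { map       = λ a → coord (f a) j
    ; injective = λ eq → f-injective (agreeOff⇒≡ (inLayer _ _) eq)
    ; edge⇔     = λ a a' → ⇔.trans (f-edge⇔ a a') (mk⇔ (to a a') (λ e → j , e , inLayer a a'))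
    }
    where
    to : ∀ a a' → ProdE Gs (f a) (f a') → Edge (Γ j) (coord (f a) j) (coord (f a') j)
    to a a' (d , e , _) with d Fin.≟ j
    ... | yes refl = e
    ... | no  d≢j  = contradiction (inLayer a a' d d≢j) (edge⇒≢ (Γ d) e)

  module Factorisation (mix : MixingClosed f j) (c₀ : Fin (order (Γ j))) where

    -- B is encoded by overwriting coordinate j with the dummy value c₀, so that its vertices
    -- are product vertices and its adjacency is that of the product.
    offLayer : Fin (order G) → ProdV Gs
    offLayer a = f a [ j ]≔ c₀

    offLayer-≡⇔ : ∀ {a a'} → offLayer a ≡ offLayer a' ⇔ AgreeOff j (f a) (f a')
    offLayer-≡⇔ {a} {a'} = mk⇔
      (λ eq k k≢j → trans (sym (coord-≔-≢ (f a) c₀ k≢j))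
                          (trans (cong (λ y → coord y k) eq) (coord-≔-≢ (f a') c₀ k≢j)))
      (agreeOff⇒≔-≡ c₀)

    module A = ImageGraph Fin._≟_ (λ a → coord (f a) j)
                          (Edge (Γ j)) (edge? (Γ j)) (edge-sym (Γ j)) (edge-irrefl (Γ j))
    module B = ImageGraph _≟ᵥ_ offLayer (ProdE Gs) ProdE? ProdE-sym ProdE-irrefl

    factors : Vec Graph 2
    factors = A.graph ∷ B.graph ∷ []

    split : Fin (order G) → ProdV factors
    split a = A.class a , B.class a , tt

    split-injective : Injective _≡_ _≡_ split
    split-injective {a} {a'} eq = f-injective (agreeOff⇒≡
      (Equivalence.to offLayer-≡⇔ (Equivalence.to B.class-≡⇔ (cong (proj₁ ∘ proj₂) eq)))
      (Equivalence.to A.class-≡⇔ (cong proj₁ eq)))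

    split-surjective : ∀ w → ∃ λ a → split a ≡ w
    split-surjective (u , v , tt) with A.class-surjective u | B.class-surjective v
    ... | t , refl | s , refl with mix t s
    ...   | z , fz≡ = z , cong₂ _,_
      (Equivalence.from A.class-≡⇔ (trans (cong (λ y → coord y j) fz≡) (coord-≔ (f s) j _)))
      (cong₂ _,_ (Equivalence.from B.class-≡⇔ (Equivalence.from offLayer-≡⇔
        (subst (λ y → AgreeOff j y (f s)) (sym fz≡) (agreeOff-≔ (f s) j _)))) refl)

    split-edge⇔ : ∀ a a' → ProdE Gs (f a) (f a') ⇔ ProdE factors (split a) (split a')
    split-edge⇔ a a' = mk⇔ to from
      where
      to : ProdE Gs (f a) (f a') → ProdE factors (split a) (split a')
      to (d , e) with d Fin.≟ j
      ... | yes refl = zero , Equivalence.from (A.edge-class⇔ a a') (proj₁ e) , λ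
        { zero 0≢0 → contradiction refl 0≢0
        ; (suc zero) _ → Equivalence.from B.class-≡⇔ (Equivalence.from offLayer-≡⇔ (proj₂ e)) }
      ... | no  d≢j  = suc zero , Equivalence.from (B.edge-class⇔ a a') (d , EdgeAt-≔ c₀ d≢j e) , λ
        { zero _ → Equivalence.from A.class-≡⇔ (proj₂ e j (≢-sym d≢j))
        ; (suc zero) 1≢1 → contradiction refl 1≢1 }
      from : ProdE factors (split a) (split a') → ProdE Gs (f a) (f a')
      from (zero , e , h) = j , Equivalence.to (A.edge-class⇔ a a') e
                              , Equivalence.to offLayer-≡⇔ (Equivalence.to B.class-≡⇔ (h (suc zero) λ ()))
      from (suc zero , e , h) with Equivalence.to (B.edge-class⇔ a a') e
      ... | d , e' with d Fin.≟ j
      ...   | yes refl = contradiction e' (¬EdgeAt-≔ c₀)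
      ...   | no  d≢j  = d , EdgeAt-≔⁻ c₀ d≢j (Equivalence.to A.class-≡⇔ (h zero λ ())) e'

    factorisation : Iso (Fin (order G)) (Edge G) (ProdV factors) (ProdE factors)
    factorisation = mk↔ₛ′ split (proj₁ ∘ split-surjective) (proj₂ ∘ split-surjective)
                              (λ a → split-injective (proj₂ (split-surjective (split a))))
                  , λ a a' → ⇔.trans (f-edge⇔ a a') (split-edge⇔ a a')

    nontrivial⇒¬prime : ∀ {a₁ a₂ a₃ a₄} →
                        coord (f a₁) j ≢ coord (f a₂) j → ¬ AgreeOff j (f a₃) (f a₄) →
                        ¬ CartesianPrime G
    nontrivial⇒¬prime layers≢ ¬agree (_ , unfactorisable) =
      unfactorisable (2 , factors , s≤s (s≤s z≤n) , nontrivial , factorisation)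
      where
      nontrivial : ∀ t → 2 ℕ.≤ order (lookup factors t)
      nontrivial zero       = A.two-classes layers≢
      nontrivial (suc zero) = B.two-classes (¬agree ∘ Equivalence.to offLayer-≡⇔)

  prime⇒inLayer : CartesianPrime G → MixingClosed f j →
                  ∀ {a₁ a₂} → coord (f a₁) j ≢ coord (f a₂) j → InLayer
  prime⇒inLayer prime mix {a₁} layers≢ a a' with agreeOff? j (f a) (f a')
  ... | yes agree  = agree
  ... | no  ¬agree = contradiction prime (nontrivial⇒¬prime layers≢ ¬agree)
    where open Factorisation mix (coord (f a₁) j)

module LayerImage {b} (Gs : Vec Graph b) (g : Iso (ProdV Gs) (ProdE Gs) (ProdV Gs) (ProdE Gs))
                  (x : ProdV Gs) (i : Fin b) where
  open Product Gs
  open Inverse (proj₁ g) using (to; from; strictlyInverseˡ; strictlyInverseʳ)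

  f : Fin (order (Γ i)) → V
  f a = to (x [ i ]≔ a)

  f-retraction : ∀ a → coord (from (f a)) i ≡ a
  f-retraction a = trans (cong (λ y → coord y i) (strictlyInverseʳ _)) (coord-≔ x i a)

  f-injective : Injective _≡_ _≡_ f
  f-injective {a} {a'} eq = trans (sym (f-retraction a)) (trans (cong (λ y → coord (from y) i) eq) (f-retraction a'))

  f-edge⇔ : ∀ a a' → Edge (Γ i) a a' ⇔ ProdE Gs (f a) (f a')
  f-edge⇔ a a' = ⇔.trans (layer-edge⇔ x i) (proj₂ g _ _)

  f-commonNeighbourClosed : CommonNeighbourClosed f
  f-commonNeighbourClosed {a} {a'} {w} fa≢fa' e e' =
    coord (from w) i , trans (cong to inLayer) (strictlyInverseˡ w)
    where
    pull : ∀ {c} → ProdE Gs (f c) w → ProdE Gs (x [ i ]≔ c) (from w)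
    pull {c} e = Equivalence.from (proj₂ g _ _) (subst (ProdE Gs (f c)) (sym (strictlyInverseˡ w)) e)
    inLayer : x [ i ]≔ coord (from w) i ≡ from w
    inLayer = trans (sym (agreeOff⇒≔-≡ _ (layer-commonNeighbour x i (fa≢fa' ∘ cong f) (pull e) (pull e'))))
                    (≔-coord (from w) i)

  f-connected : Connected V (ProdE Gs) → ∀ a a' → Star (λ m m' → ProdE Gs (f m) (f m')) a a'
  f-connected conn a a' = Star.map (Equivalence.to (f-edge⇔ _ _)) (factor-connected conn x i a a')

  embedding : Connected V (ProdE Gs) → CartesianPrime (Γ i) →
              ∀ j {a₁ a₂} → EdgeAt j (f a₁) (f a₂) → Embedding (Γ i) (Γ j)
  embedding conn prime j e = inLayer⇒embedding (prime⇒inLayer prime mix (edge⇒≢ (Γ j) (proj₁ e)))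
    where
    open InducedSubgraph Gs (Γ i) f f-injective f-edge⇔ j
    mix : MixingClosed f j
    mix = SquareCompletion.mixingClosed Gs f f-commonNeighbourClosed j (f-connected conn)

module PrimeFactors {b} (Gs : Vec Graph b) (conn : Connected (ProdV Gs) (ProdE Gs))
                    (prime : ∀ i → CartesianPrime (lookup Gs i)) where
  open Product Gs

  x : V
  x = tabulateᵥ λ k → Fin.fromℕ< (ℕ.<⇒≤ (proj₁ (prime k)))

  neighbour : ∀ k → ∃ (Edge (Γ k) (coord x k))
  neighbour k = connected⇒neighbour (factor-connected conn x k) (proj₁ (prime k)) (coord x k)

  arcTransitive⇒embedding : ArcTransitive V (ProdE Gs) → ∀ i j → Embedding (Γ i) (Γ j)
  arcTransitive⇒embedding arcTransitive i j
    with neighbour i | neighbour j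
  ... | c , e | c' , e'
    -- g carries the i-edge at x to the j-edge at x, so the image of the i-layer has a j-edge.
    with arcTransitive x (x [ i ]≔ c) x (x [ j ]≔ c') (i , ≔-EdgeAt x i e) (j , ≔-EdgeAt x j e')
  ... | g , gx≡x , gxᵢ≡xⱼ = LayerImage.embedding Gs g x i conn (prime i) j
    (subst₂ (EdgeAt j) (sym (trans (cong (Inverse.to (proj₁ g)) (≔-coord x i)) gx≡x)) (sym gxᵢ≡xⱼ)
            (≔-EdgeAt x j e'))

lemma2p3 : (b : ℕ) (Gs : Vec Graph b) →
    SimpleProduct Gs →
    Connected (ProdV Gs) (ProdE Gs) →
    ArcTransitive (ProdV Gs) (ProdE Gs) →
    Σ Graph λ Γ₀ → (i : Fin b) → GraphEq (lookup Gs i) Γ₀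
lemma2p3 zero    Gs (() , _)               conn arcTransitive
lemma2p3 (suc b) Gs (_ , prime , simple) conn arcTransitive = lookup Gs zero , equal
  where
  open PrimeFactors Gs conn prime
  iso : ∀ i j → GraphIso (lookup Gs i) (lookup Gs j)
  iso i j = mutualEmbeddings⇒iso (arcTransitive⇒embedding arcTransitive i j)
                                 (arcTransitive⇒embedding arcTransitive j i)
  equal : ∀ i → GraphEq (lookup Gs i) (lookup Gs zero)
  equal zero    = refl , λ _ _ → refl
  equal (suc i) =
    GraphEq-sym {lookup Gs zero} {lookup Gs (suc i)} (simple zero (suc i) (s≤s z≤n) (iso zero (suc i)))
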